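{- Let $B$ be an endofunctor on the category $\mathbf{Pos}$ of posets and monotone maps, and for $i=1,2$ let $x_i$ be a state of a $B$-coalgebra $(X_i,\le,\vartheta_i)$. Then $x_1 =_! x_2$ if and only if both $x_1 \le_! x_2$ and $x_2 \le_! x_1$.
   Context: A (monotone) $B$-coalgebra is a triple $(X,\le,\vartheta)$ where $(X,\le)$ is a poset and $\vartheta:(X,\le)\to B(X,\le)$ is monotone. A coalgebra homomorphism $h:(X,\le,\vartheta)\to(Y,\le,\delta)$ is a monotone map $h:(X,\le)\to(Y,\le)$ with $\delta\circ h = B(h)\circ\vartheta$. For states $x_1\in X_1$, $x_2\in X_2$ of $B$-coalgebras $(X_1,\le,\vartheta_1)$, $(X_2,\le,\vartheta_2)$: $x_1\le_! x_2$ ($x_1$ is behaviourally below $x_2$) means there exist a $B$-coalgebra $(Y,\le,\delta)$ and coalgebra homomorphisms $h_i:(X_i,\le,\vartheta_i)\to(Y,\le,\delta)$, $i=1,2$, with $h_1(x_1)\le h_2(x_2)$; $x_1 =_! x_2$ (behavioural equivalence) means there exist such $(Y,\le,\delta)$, $h_1,h_2$ with $h_1(x_1)=h_2(x_2)$. -}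

module Defs where

open import Level using (Level; suc)
open import Data.Product using (Σ; Σ-syntax; _×_; _,_)
open import Relation.Binary.Bundles using (Poset)
open import Relation.Binary.Morphism.Bundles using (PosetHomomorphism)
import Relation.Binary.Morphism.Construct.Identity as Id
import Relation.Binary.Morphism.Construct.Composition as Comp

-- The category Pos (at universe level ℓ): objects are posets (carrier
-- with a setoid equality _≈_ and a partial order _≤_ antisymmetric
-- w.r.t. _≈_), morphisms are monotone maps (PosetHomomorphism), and two
-- morphisms are equal when they agree pointwise up to _≈_.

Pos : (ℓ : Level) → Set (suc ℓ)
Pos ℓ = Poset ℓ ℓ ℓ

Carrier : ∀ {ℓ} → Pos ℓ → Set ℓ
Carrier P = Poset.Carrier P

Hom : ∀ {ℓ} → Pos ℓ → Pos ℓ → Set ℓ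
Hom P Q = PosetHomomorphism P Q

app : ∀ {ℓ} {P Q : Pos ℓ} → Hom P Q → Carrier P → Carrier Q
app f = PosetHomomorphism.⟦_⟧ f

_≗_ : ∀ {ℓ} {P Q : Pos ℓ} → Hom P Q → Hom P Q → Set ℓ
_≗_ {Q = Q} f g = ∀ x → Poset._≈_ Q (app f x) (app g x)

idH : ∀ {ℓ} (P : Pos ℓ) → Hom P P
idH P = Id.posetHomomorphism P

_∘H_ : ∀ {ℓ} {P Q R : Pos ℓ} → Hom Q R → Hom P Q → Hom P R
g ∘H f = Comp.posetHomomorphism f g

record Endofunctor (ℓ : Level) : Set (suc ℓ) where
  field
    F₀     : Pos ℓ → Pos ℓ
    F₁     : ∀ {P Q} → Hom P Q → Hom (F₀ P) (F₀ Q)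
    F-resp : ∀ {P Q} {f g : Hom P Q} → f ≗ g → F₁ f ≗ F₁ g
    F-id   : ∀ {P} → F₁ (idH P) ≗ idH (F₀ P)
    F-comp : ∀ {P Q R} (f : Hom P Q) (g : Hom Q R) →
             F₁ (g ∘H f) ≗ (F₁ g ∘H F₁ f)

module _ {ℓ : Level} (B : Endofunctor ℓ) where
  open Endofunctor B

  record Coalgebra : Set (suc ℓ) where
    field
      X : Pos ℓ
      ϑ : Hom X (F₀ X)

  open Coalgebra

  State : Coalgebra → Set ℓ
  State C = Carrier (X C)

  record CoalgHom (C D : Coalgebra) : Set ℓ where
    field
      h       : Hom (X C) (X D)
      commute : (ϑ D ∘H h) ≗ (F₁ h ∘H ϑ C)

  open CoalgHom

  BehBelow : {C₁ C₂ : Coalgebra} → State C₁ → State C₂ → Set (suc ℓ)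
  BehBelow {C₁} {C₂} x₁ x₂ =
    Σ[ D ∈ Coalgebra ] Σ[ h₁ ∈ CoalgHom C₁ D ] Σ[ h₂ ∈ CoalgHom C₂ D ]
      Poset._≤_ (X D) (app (h h₁) x₁) (app (h h₂) x₂)

  BehEq : {C₁ C₂ : Coalgebra} → State C₁ → State C₂ → Set (suc ℓ)
  BehEq {C₁} {C₂} x₁ x₂ =
    Σ[ D ∈ Coalgebra ] Σ[ h₁ ∈ CoalgHom C₁ D ] Σ[ h₂ ∈ CoalgHom C₂ D ]
      Poset._≈_ (X D) (app (h h₁) x₁) (app (h h₂) x₂)

{-# OPTIONS --safe #-}
-- If x₁ ≤! x₂ is witnessed by homomorphisms h₁, h₂ into D and x₂ ≤! x₁ by
-- k₁, k₂ into D', glue D and D' along the span D ← C₁ + C₂ → D' given by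
-- [h₁, h₂] and [k₁, k₂]. In the glued coalgebra h₁ x₁ ≤ h₂ x₂ ≈ k₂ x₂ and
-- k₂ x₂ ≤ k₁ x₁ ≈ h₁ x₁, so antisymmetry identifies the images of x₁ and x₂.
module Submission where

open import Defs
open import Data.Product using (_×_; _,_; proj₁)
open import Data.Sum using (_⊎_; inj₁; inj₂; [_,_])
open import Data.Sum.Relation.Binary.Pointwise using (⊎-poset; inj₁; inj₂)
open import Function.Bundles using (_⇔_; mk⇔)
open import Level using (Level)
open import Relation.Binary.Bundles using (Poset)
open import Relation.Binary.Morphism.Bundles using (PosetHomomorphism)
import Relation.Binary.Reasoning.PartialOrder as PosetReasoning
import Relation.Binary.Reasoning.Setoid as SetoidReasoning

[_,_]H : ∀ {ℓ} {P Q R : Pos ℓ} → Hom P R → Hom Q R → Hom (⊎-poset P Q) R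
[_,_]H {P = P} {Q} {R} f g = record
  { ⟦_⟧ = [ app f , app g ]
  ; isOrderHomomorphism = record { cong = copair-cong ; mono = copair-mono }
  }
  where
  open PosetHomomorphism
  copair-cong : ∀ {x y} → Poset._≈_ (⊎-poset P Q) x y →
                Poset._≈_ R ([ app f , app g ] x) ([ app f , app g ] y)
  copair-cong (inj₁ e) = cong f e
  copair-cong (inj₂ e) = cong g e
  copair-mono : ∀ {x y} → Poset._≤_ (⊎-poset P Q) x y →
                Poset._≤_ R ([ app f , app g ] x) ([ app f , app g ] y)
  copair-mono (inj₁ e) = mono f e
  copair-mono (inj₂ e) = mono g e

inj₁H : ∀ {ℓ} {P Q : Pos ℓ} → Hom P (⊎-poset P Q)
inj₁H = record { ⟦_⟧ = inj₁ ; isOrderHomomorphism = record { cong = inj₁ ; mono = inj₁ } }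

inj₂H : ∀ {ℓ} {P Q : Pos ℓ} → Hom Q (⊎-poset P Q)
inj₂H = record { ⟦_⟧ = inj₂ ; isOrderHomomorphism = record { cong = inj₂ ; mono = inj₂ } }

module _ {ℓ : Level} (B : Endofunctor ℓ) where
  open Endofunctor B
  open Coalgebra
  open CoalgHom

  module _ {P : Pos ℓ} where
    open Poset (F₀ P) using () renaming (_≈_ to _≈F_)

    F-triangle : ∀ {Q R : Pos ℓ} (f : Hom Q R) (g : Hom R P) (k : Hom Q P) →
                 (g ∘H f) ≗ k → ∀ x → app (F₁ g) (app (F₁ f) x) ≈F app (F₁ k) x
    F-triangle f g k gf≗k x = begin
      app (F₁ g) (app (F₁ f) x) ≈⟨ F-comp f g x ⟨
      app (F₁ (g ∘H f)) x       ≈⟨ F-resp gf≗k x ⟩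
      app (F₁ k) x              ∎
      where open SetoidReasoning (Poset.Eq.setoid (F₀ P))

  _∘C_ : {C D E : Coalgebra B} → CoalgHom B D E → CoalgHom B C D → CoalgHom B C E
  _∘C_ {C} {D} {E} q p = record { h = h q ∘H h p ; commute = commute-∘ }
    where
    open SetoidReasoning (Poset.Eq.setoid (F₀ (X E)))
    commute-∘ : (ϑ E ∘H (h q ∘H h p)) ≗ (F₁ (h q ∘H h p) ∘H ϑ C)
    commute-∘ c = begin
      app (ϑ E) (app (h q) (app (h p) c))            ≈⟨ commute q (app (h p) c) ⟩
      app (F₁ (h q)) (app (ϑ D) (app (h p) c))       ≈⟨ PosetHomomorphism.cong (F₁ (h q)) (commute p c) ⟩
      app (F₁ (h q)) (app (F₁ (h p)) (app (ϑ C) c))  ≈⟨ F-triangle (h p) (h q) (h q ∘H h p) (λ _ → Poset.Eq.refl (X E)) (app (ϑ C) c) ⟩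
      app (F₁ (h q ∘H h p)) (app (ϑ C) c)            ∎

  module Coproduct (C₁ C₂ : Coalgebra B) where

    coalgebra : Coalgebra B
    coalgebra = record
      { X = ⊎-poset (X C₁) (X C₂)
      ; ϑ = [ F₁ inj₁H ∘H ϑ C₁ , F₁ inj₂H ∘H ϑ C₂ ]H
      }

    copair : {D : Coalgebra B} → CoalgHom B C₁ D → CoalgHom B C₂ D → CoalgHom B coalgebra D
    copair {D} h₁ h₂ = record { h = k ; commute = commute-copair }
      where
      k : Hom (X coalgebra) (X D)
      k = [ h h₁ , h h₂ ]H
      open SetoidReasoning (Poset.Eq.setoid (F₀ (X D)))
      commute-copair : (ϑ D ∘H k) ≗ (F₁ k ∘H ϑ coalgebra)
      commute-copair (inj₁ c) = begin
        app (ϑ D) (app (h h₁) c)                ≈⟨ commute h₁ c ⟩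
        app (F₁ (h h₁)) (app (ϑ C₁) c)          ≈⟨ F-triangle inj₁H k (h h₁) (λ _ → Poset.Eq.refl (X D)) (app (ϑ C₁) c) ⟨
        app (F₁ k) (app (F₁ inj₁H) (app (ϑ C₁) c)) ∎
      commute-copair (inj₂ c) = begin
        app (ϑ D) (app (h h₂) c)                ≈⟨ commute h₂ c ⟩
        app (F₁ (h h₂)) (app (ϑ C₂) c)          ≈⟨ F-triangle inj₂H k (h h₂) (λ _ → Poset.Eq.refl (X D)) (app (ϑ C₂) c) ⟨
        app (F₁ k) (app (F₁ inj₂H) (app (ϑ C₂) c)) ∎

  module Pushout {S D D' : Coalgebra B} (f : CoalgHom B S D) (f' : CoalgHom B S D') where
    private
      module D  = Poset (X D)
      module D' = Poset (X D')

    -- The preorder generated by D, D' and f s ≈ f' s; taking its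
    -- antisymmetric part as the equality makes it a poset without a quotient.
    data _⊑_ : State B D ⊎ State B D' → State B D ⊎ State B D' → Set ℓ where
      left    : ∀ {a b} → a D.≤ b → inj₁ a ⊑ inj₁ b
      right   : ∀ {a b} → a D'.≤ b → inj₂ a ⊑ inj₂ b
      glue    : ∀ s → inj₁ (app (h f) s) ⊑ inj₂ (app (h f') s)
      glue⁻¹  : ∀ s → inj₂ (app (h f') s) ⊑ inj₁ (app (h f) s)
      ⊑-trans : ∀ {x y z} → x ⊑ y → y ⊑ z → x ⊑ z

    ⊑-refl : ∀ {x} → x ⊑ x
    ⊑-refl {inj₁ a} = left D.refl
    ⊑-refl {inj₂ a} = right D'.refl

    poset : Pos ℓ
    poset = record
      { Carrier = State B D ⊎ State B D'
      ; _≈_ = λ x y → x ⊑ y × y ⊑ x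
      ; _≤_ = _⊑_
      ; isPartialOrder = record
        { isPreorder = record
          { isEquivalence = record
            { refl = ⊑-refl , ⊑-refl
            ; sym = λ (x⊑y , y⊑x) → y⊑x , x⊑y
            ; trans = λ (x⊑y , y⊑x) (y⊑z , z⊑y) → ⊑-trans x⊑y y⊑z , ⊑-trans z⊑y y⊑x
            }
          ; reflexive = proj₁
          ; trans = ⊑-trans
          }
        ; antisym = _,_
        }
      }

    private
      module P  = Poset poset
      module FQ = Poset (F₀ poset)

    ι₁H : Hom (X D) poset
    ι₁H = record { ⟦_⟧ = inj₁ ; isOrderHomomorphism = record
      { cong = λ a≈b → left (D.reflexive a≈b) , left (D.reflexive (D.Eq.sym a≈b)) ; mono = left } }

    ι₂H : Hom (X D') poset
    ι₂H = record { ⟦_⟧ = inj₂ ; isOrderHomomorphism = record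
      { cong = λ a≈b → right (D'.reflexive a≈b) , right (D'.reflexive (D'.Eq.sym a≈b)) ; mono = right } }

    square : (ι₁H ∘H h f) ≗ (ι₂H ∘H h f')
    square s = glue s , glue⁻¹ s

    θ : P.Carrier → FQ.Carrier
    θ (inj₁ a) = app (F₁ ι₁H) (app (ϑ D) a)
    θ (inj₂ a) = app (F₁ ι₂H) (app (ϑ D') a)

    θ-square : ∀ s → θ (inj₁ (app (h f) s)) FQ.≈ θ (inj₂ (app (h f') s))
    θ-square s = begin
      app (F₁ ι₁H) (app (ϑ D) (app (h f) s))         ≈⟨ PosetHomomorphism.cong (F₁ ι₁H) (commute f s) ⟩
      app (F₁ ι₁H) (app (F₁ (h f)) (app (ϑ S) s))    ≈⟨ F-triangle (h f) ι₁H (ι₂H ∘H h f') square (app (ϑ S) s) ⟩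
      app (F₁ (ι₂H ∘H h f')) (app (ϑ S) s)           ≈⟨ F-triangle (h f') ι₂H (ι₂H ∘H h f') (λ _ → P.Eq.refl) (app (ϑ S) s) ⟨
      app (F₁ ι₂H) (app (F₁ (h f')) (app (ϑ S) s))   ≈⟨ PosetHomomorphism.cong (F₁ ι₂H) (commute f' s) ⟨
      app (F₁ ι₂H) (app (ϑ D') (app (h f') s))       ∎
      where open SetoidReasoning FQ.Eq.setoid

    θ-mono : ∀ {x y} → x ⊑ y → θ x FQ.≤ θ y
    θ-mono (left a≤b)        = PosetHomomorphism.mono (F₁ ι₁H) (PosetHomomorphism.mono (ϑ D) a≤b)
    θ-mono (right a≤b)       = PosetHomomorphism.mono (F₁ ι₂H) (PosetHomomorphism.mono (ϑ D') a≤b)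
    θ-mono (glue s)          = FQ.reflexive (θ-square s)
    θ-mono (glue⁻¹ s)        = FQ.reflexive (FQ.Eq.sym (θ-square s))
    θ-mono (⊑-trans x⊑y y⊑z) = FQ.trans (θ-mono x⊑y) (θ-mono y⊑z)

    coalgebra : Coalgebra B
    coalgebra = record { X = poset ; ϑ = record { ⟦_⟧ = θ ; isOrderHomomorphism = record
      { cong = λ (x⊑y , y⊑x) → FQ.antisym (θ-mono x⊑y) (θ-mono y⊑x) ; mono = θ-mono } } }

    ι₁ : CoalgHom B D coalgebra
    ι₁ = record { h = ι₁H ; commute = λ _ → FQ.Eq.refl }

    ι₂ : CoalgHom B D' coalgebra
    ι₂ = record { h = ι₂H ; commute = λ _ → FQ.Eq.refl }

  module _ (C₁ C₂ : Coalgebra B) {x₁ : State B C₁} {x₂ : State B C₂} where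

    BehEq⇒BehBelow : BehEq B {C₁} {C₂} x₁ x₂ → BehBelow B {C₁} {C₂} x₁ x₂
    BehEq⇒BehBelow (D , h₁ , h₂ , eq) = D , h₁ , h₂ , Poset.reflexive (X D) eq

    BehEq-sym : BehEq B {C₁} {C₂} x₁ x₂ → BehEq B {C₂} {C₁} x₂ x₁
    BehEq-sym (D , h₁ , h₂ , eq) = D , h₂ , h₁ , Poset.Eq.sym (X D) eq

    BehBelow-antisym : BehBelow B {C₁} {C₂} x₁ x₂ → BehBelow B {C₂} {C₁} x₂ x₁ →
                       BehEq B {C₁} {C₂} x₁ x₂
    BehBelow-antisym (D , h₁ , h₂ , h₁x₁≤h₂x₂) (D' , k₂ , k₁ , k₂x₂≤k₁x₁) =
      coalgebra , ι₁ ∘C h₁ , ι₂ ∘C k₂ , antisym ι₁h₁x₁≤ι₂k₂x₂ ι₂k₂x₂≤ι₁h₁x₁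
      where
      open Coproduct C₁ C₂ using (copair)
      open Pushout (copair h₁ h₂) (copair k₁ k₂)
      open Poset poset using (antisym)
      open PosetHomomorphism using (mono)
      open PosetReasoning poset

      ι₁h₁x₁≤ι₂k₂x₂ : inj₁ (app (h h₁) x₁) ⊑ inj₂ (app (h k₂) x₂)
      ι₁h₁x₁≤ι₂k₂x₂ = begin
        inj₁ (app (h h₁) x₁) ≤⟨ mono ι₁H h₁x₁≤h₂x₂ ⟩
        inj₁ (app (h h₂) x₂) ≈⟨ square (inj₂ x₂) ⟩
        inj₂ (app (h k₂) x₂) ∎

      ι₂k₂x₂≤ι₁h₁x₁ : inj₂ (app (h k₂) x₂) ⊑ inj₁ (app (h h₁) x₁)
      ι₂k₂x₂≤ι₁h₁x₁ = begin
        inj₂ (app (h k₂) x₂) ≤⟨ mono ι₂H k₂x₂≤k₁x₁ ⟩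
        inj₂ (app (h k₁) x₁) ≈⟨ square (inj₁ x₁) ⟨
        inj₁ (app (h h₁) x₁) ∎

lemma2p7 : ∀ {ℓ} (B : Endofunctor ℓ) (C₁ C₂ : Coalgebra B)
             (x₁ : State B C₁) (x₂ : State B C₂) →
             BehEq B {C₁} {C₂} x₁ x₂ ⇔
               (BehBelow B {C₁} {C₂} x₁ x₂ × BehBelow B {C₂} {C₁} x₂ x₁)
lemma2p7 B C₁ C₂ x₁ x₂ = mk⇔
  (λ x₁=x₂ → BehEq⇒BehBelow B C₁ C₂ x₁=x₂ , BehEq⇒BehBelow B C₂ C₁ (BehEq-sym B C₁ C₂ x₁=x₂))
  (λ (x₁≤x₂ , x₂≤x₁) → BehBelow-antisym B C₁ C₂ x₁≤x₂ x₂≤x₁)
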